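{- Assume the setting of the context, with integers $0\le d<e\le\lambda_1$. Let $(S,T)\in\boldsymbol{S}_{(d,e)}$ and let $U^\ast\subseteq\rho/d$ be a set of positions with $(r,\rho_r)\in U^\ast$ such that both $S'_{U^\ast}$ and $T'_{U^\ast}$ are skew SSYT's. Then $U(S,T)\subseteq U^\ast$.
   Context: Fix integers $N \ge n\ge 1$ and partitions $\rho=(\rho_1,\ldots,\rho_n)$, $\lambda=(\lambda_1,\ldots,\lambda_n)$ (weakly decreasing nonnegative integers) such that there is exactly one $r$ with $\lambda_r=\rho_r-1$ and $\lambda_i=\rho_i$ for $i\ne r$. Position $(i,j)$ means row $i$, column $j$. For an integer $d$, $\rho/d$ is the skew shape obtained from the Young diagram of $\rho$ by removing the first $d$ boxes of the first row (similarly $\lambda/e$). A skew SSYT is a filling of a skew shape with positive integers satisfying the "skew SSYT requirements": entries weakly increase along rows and strictly increase down columns. $\boldsymbol{S}_{(d,e)}$ is the set of pairs $(S,T)$ with $S$ a skew SSYT of shape $\rho/d$ and $T$ a skew SSYT of shape $\lambda/e$, both with entries in $\{1,\ldots,N-1\}$; $S_{i,j}$ denotes an entry. For $(S,T)\in\boldsymbol{S}_{(d,e)}$ use the convention $T_{1,j}=0$ for $d<j\le e$, and a box with entry $0$ is regarded as missing. For a set $U$ of positions in $\rho/d$ containing $(r,\rho_r)$, $S'_U$ is obtained from $T$ by adding a box at $(r,\rho_r)$ with entry $S_{r,\rho_r}$ and replacing $T_{i,j}$ by $S_{i,j}$ for each $(i,j)\in U\setminus\{(r,\rho_r)\}$;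 $T'_U$ is obtained from $S$ by removing the box at $(r,\rho_r)$ and replacing $S_{i,j}$ by $T_{i,j}$ for each $(i,j)\in U\setminus\{(r,\rho_r)\}$. A sequence $\{(B_k,C_k)\}_{1\le k\le M}$ ($M\ge0$) of pairs of positions in $\rho/d$ is a spanning tree for $(S,T)$ if, with $B_0=(r,\rho_r)$ and $U_K=\{B_0,\ldots,B_K\}$: (1) $B_k\in\rho/d\setminus U_{k-1}$ and $C_k\in U_{k-1}$ for each $k$; (2) $B_k$ and $C_k$ are adjacent; (3) for each $k$, $S'_{U_{k-1}}$ and $T'_{U_{k-1}}$ are not both skew SSYT's, and $(B_k,C_k)$ is a pair of adjacent positions at which one or both of them fail the skew SSYT requirements; (4) there is no pair $(B_{M+1},C_{M+1})$ of adjacent positions at which $S'_{U_M}$ or $T'_{U_M}$ fails the skew SSYT requirements. The set $U_M$ does not depend on the choice of spanning tree and is denoted $U(S,T)$. -}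

module Defs where

open import Data.Nat using (ℕ; zero; suc; _+_; _≤_; _<_; _≥_; _>_)
open import Data.Nat.Properties using (_≟_)
open import Data.Product using (_×_; _,_; proj₁)
open import Data.Product.Properties using (≡-dec)
open import Data.Sum using (_⊎_)
open import Data.List using (List; []; _∷_; map)
open import Data.List.Membership.Propositional using (_∈_; _∉_)
import Data.List.Membership.DecPropositional as DecMem
open import Data.Bool using (if_then_else_; _∧_)
open import Data.Nat using (_≤ᵇ_)
open import Relation.Nullary using (¬_; does)
open import Relation.Binary.PropositionalEquality using (_≡_)

-- Positions (row i, column j), rows and columns indexed from 1.
Pos : Set
Pos = ℕ × ℕ

_≟ₚ_ : (p q : Pos) → Relation.Nullary.Dec (p ≡ q)
_≟ₚ_ = ≡-dec _≟_ _≟_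

open DecMem _≟ₚ_ using (_∈?_)

-- A filling assigns an entry to every position (only values on the
-- relevant domain matter).
Filling : Set
Filling = Pos → ℕ

IsPartition : ℕ → (ℕ → ℕ) → Set
IsPartition n ρ = ∀ i → 1 ≤ i → i < n → ρ (suc i) ≤ ρ i

-- Membership of position (i,j) in the skew shape ρ/d
-- (Young diagram of ρ with the first d boxes of row 1 removed).
InSkew : ℕ → (ℕ → ℕ) → ℕ → Pos → Set
InSkew n ρ d (i , j) =
  (1 ≤ i) × (i ≤ n) × (1 ≤ j) × (j ≤ ρ i) × (i ≡ 1 → d < j)

right : Pos → Pos
right (i , j) = (i , suc j)

below : Pos → Pos
below (i , j) = (suc i , j)

Adjacent : Pos → Pos → Set
Adjacent p q = (q ≡ right p) ⊎ (p ≡ right q) ⊎ (q ≡ below p) ⊎ (p ≡ below q)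

-- An entry 0 encodes a missing box (only occurs at the start of row 1).
FailsAt : (Pos → Set) → Filling → Pos → Pos → Set
FailsAt D F p q = D p × D q × ((q ≡ right p × F p > F q) ⊎ (q ≡ below p × F p ≥ F q))

FailsAtPair : (Pos → Set) → Filling → Pos → Pos → Set
FailsAtPair D F p q = FailsAt D F p q ⊎ FailsAt D F q p

SkewReq : (Pos → Set) → Filling → Set
SkewReq D F = ∀ p q → ¬ FailsAt D F p q

IsSSYT : ℕ → ℕ → (ℕ → ℕ) → ℕ → Filling → Set
IsSSYT N n ρ d F =
  (∀ p → InSkew n ρ d p → (1 ≤ F p) × (suc (F p) ≤ N)) × SkewReq (InSkew n ρ d) F

-- T with the convention T_{1,j} = 0 for j ≤ e (so for d < j ≤ e).
Tz : ℕ → Filling → Filling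
Tz e T (i , j) = if does (i ≟ 1) ∧ (j ≤ᵇ e) then 0 else T (i , j)

-- S'_U (for U containing (r,ρ_r)): on positions of U the entry of S,
-- elsewhere the entry of T (with T_{1,j} = 0 for d<j≤e, i.e. missing).
-- Its domain is taken to be ρ/d (entries 0 are missing boxes).
S′ : ℕ → Filling → Filling → List Pos → Filling
S′ e S T U p = if does (p ∈? U) then S p else Tz e T p

-- T'_U: on positions of U∖{(r,ρ_r)} the entry of T, elsewhere S;
-- its domain is ρ/d with the box (r,ρ_r) removed.
T′ : ℕ → Filling → Filling → List Pos → Filling
T′ e S T U p = if does (p ∈? U) then Tz e T p else S p

DomS′ : ℕ → (ℕ → ℕ) → ℕ → Pos → Set
DomS′ n ρ d = InSkew n ρ d

DomT′ : ℕ → (ℕ → ℕ) → ℕ → Pos → Pos → Set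
DomT′ n ρ d B₀ p = InSkew n ρ d p × ¬ (p ≡ B₀)

-- Validity of a sequence (B_k,C_k)_{k} of pairs, continuing from the
-- current set U = U_{k-1}.  The empty tail encodes condition (4);
-- a step encodes conditions (1)-(3).
SpanningFrom : ℕ → (ℕ → ℕ) → ℕ → ℕ → Pos → Filling → Filling →
               List Pos → List (Pos × Pos) → Set
SpanningFrom n ρ d e B₀ S T U [] =
  ∀ p q → (¬ FailsAtPair (DomS′ n ρ d) (S′ e S T U) p q)
        × (¬ FailsAtPair (DomT′ n ρ d B₀) (T′ e S T U) p q)
SpanningFrom n ρ d e B₀ S T U ((B , C) ∷ rest) =
  InSkew n ρ d B × B ∉ U × C ∈ U × Adjacent B C ×
  (FailsAtPair (DomS′ n ρ d) (S′ e S T U) B C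
     ⊎ FailsAtPair (DomT′ n ρ d B₀) (T′ e S T U) B C) ×
  SpanningFrom n ρ d e B₀ S T (B ∷ U) rest

-- A spanning tree for (S,T), with B_0 = (r,ρ_r) and U_0 = {B_0}.
IsSpanningTree : ℕ → (ℕ → ℕ) → ℕ → ℕ → ℕ → Filling → Filling →
                 List (Pos × Pos) → Set
IsSpanningTree n ρ r d e S T tree =
  SpanningFrom n ρ d e (r , ρ r) S T ((r , ρ r) ∷ []) tree

-- U_M = {B_0,…,B_M}; by the paper this is U(S,T).
TreeSet : (ℕ → ℕ) → ℕ → List (Pos × Pos) → List Pos
TreeSet ρ r tree = (r , ρ r) ∷ map proj₁ tree

{-# OPTIONS --safe #-}
module Submission where

open import Defs
open import Data.Nat using (ℕ; _+_; _≤_; _<_; _>_; _≥_)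
open import Data.Product using (_×_; _,_; proj₁)
open import Data.Sum using (_⊎_; inj₁; inj₂)
open import Data.Bool using (if_then_else_)
open import Data.List using (List; []; _∷_; map)
open import Data.List.Membership.Propositional using (_∈_; _∉_)
import Data.List.Membership.DecPropositional as DecMem
open import Data.List.Relation.Unary.All using (All)
open import Data.List.Relation.Unary.Any using (here)
open import Data.List.Relation.Binary.Subset.Propositional using (_⊆_)
open import Data.List.Relation.Binary.Subset.Propositional.Properties using (∈-∷⁺ʳ)
open import Relation.Nullary using (¬_; does)
open import Relation.Nullary.Decidable using (dec-true; dec-false; decidable-stable)
open import Relation.Binary.PropositionalEquality using (_≡_; refl; cong; subst₂)

open DecMem _≟ₚ_ using (_∈?_)

-- Spanning trees only ever add a box B that sits next to the current set U and
-- witnesses a failure of S′_U or T′_U at (B, C) with C ∈ U.  If U ⊆ U* but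
-- B ∉ U*, then both fillings read the same entries at B and C for U and for U*,
-- so the failure would persist for U*, which has none.  By induction along the
-- tree, every B_k lies in U*.

FailsAt-cong : ∀ {D} {F G : Filling} {p q} → F p ≡ G p → F q ≡ G q →
               FailsAt D F p q → FailsAt D G p q
FailsAt-cong Fp≡Gp Fq≡Gq (Dp , Dq , inj₁ (q≡right , Fp>Fq)) =
  Dp , Dq , inj₁ (q≡right , subst₂ _>_ Fp≡Gp Fq≡Gq Fp>Fq)
FailsAt-cong Fp≡Gp Fq≡Gq (Dp , Dq , inj₂ (q≡below , Fp≥Fq)) =
  Dp , Dq , inj₂ (q≡below , subst₂ _≥_ Fp≡Gp Fq≡Gq Fp≥Fq)

FailsAtPair-cong : ∀ {D} {F G : Filling} {p q} → F p ≡ G p → F q ≡ G q →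
                   FailsAtPair D F p q → FailsAtPair D G p q
FailsAtPair-cong Fp≡Gp Fq≡Gq (inj₁ fails) = inj₁ (FailsAt-cong Fp≡Gp Fq≡Gq fails)
FailsAtPair-cong Fp≡Gp Fq≡Gq (inj₂ fails) = inj₂ (FailsAt-cong Fq≡Gq Fp≡Gp fails)

SkewReq⇒¬FailsAtPair : ∀ {D F} → SkewReq D F → ∀ {p q} → ¬ FailsAtPair D F p q
SkewReq⇒¬FailsAtPair ok (inj₁ fails) = ok _ _ fails
SkewReq⇒¬FailsAtPair ok (inj₂ fails) = ok _ _ fails

-- Both S′ e S T U and T′ e S T U are definitionally of this form.
splice : List Pos → Filling → Filling → Filling
splice U F G p = if does (p ∈? U) then F p else G p

module _ {F G : Filling} {U V : List Pos} where

  splice-∈ : ∀ {p} → p ∈ U → p ∈ V → splice U F G p ≡ splice V F G p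
  splice-∈ {p} p∈U p∈V
    rewrite dec-true (p ∈? U) p∈U | dec-true (p ∈? V) p∈V = refl

  splice-∉ : ∀ {p} → p ∉ U → p ∉ V → splice U F G p ≡ splice V F G p
  splice-∉ {p} p∉U p∉V
    rewrite dec-false (p ∈? U) p∉U | dec-false (p ∈? V) p∉V = refl

  splice-failure-outside : ∀ {D B C} → U ⊆ V → B ∉ U → C ∈ U → B ∉ V →
                           FailsAtPair D (splice U F G) B C →
                           FailsAtPair D (splice V F G) B C
  splice-failure-outside U⊆V B∉U C∈U B∉V =
    FailsAtPair-cong (splice-∉ B∉U B∉V) (splice-∈ C∈U (U⊆V C∈U))

  splice-failure-inside : ∀ {D B C} → SkewReq D (splice V F G) →
                          U ⊆ V → B ∉ U → C ∈ U →
                          FailsAtPair D (splice U F G) B C → B ∈ V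
  splice-failure-inside {B = B} ok U⊆V B∉U C∈U fails =
    decidable-stable (B ∈? V) λ B∉V →
      SkewReq⇒¬FailsAtPair ok (splice-failure-outside U⊆V B∉U C∈U B∉V fails)

spanning-step-∈ : ∀ {n ρ d e B₀ S T U V B C} →
                  SkewReq (DomS′ n ρ d) (S′ e S T V) →
                  SkewReq (DomT′ n ρ d B₀) (T′ e S T V) →
                  U ⊆ V → B ∉ U → C ∈ U →
                  FailsAtPair (DomS′ n ρ d) (S′ e S T U) B C
                    ⊎ FailsAtPair (DomT′ n ρ d B₀) (T′ e S T U) B C →
                  B ∈ V
spanning-step-∈ okS okT U⊆V B∉U C∈U (inj₁ failsS) = splice-failure-inside okS U⊆V B∉U C∈U failsS
spanning-step-∈ okS okT U⊆V B∉U C∈U (inj₂ failsT) = splice-failure-inside okT U⊆V B∉U C∈U failsT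

SpanningFrom-⊆ : ∀ {n ρ d e B₀ S T U V} tree →
                 SkewReq (DomS′ n ρ d) (S′ e S T V) →
                 SkewReq (DomT′ n ρ d B₀) (T′ e S T V) →
                 U ⊆ V → SpanningFrom n ρ d e B₀ S T U tree →
                 map proj₁ tree ⊆ V
SpanningFrom-⊆ [] okS okT U⊆V _ ()
SpanningFrom-⊆ {V = V} ((B , C) ∷ rest) okS okT U⊆V (_ , B∉U , C∈U , _ , fails , spanning) =
  ∈-∷⁺ʳ B∈V (SpanningFrom-⊆ rest okS okT (∈-∷⁺ʳ B∈V U⊆V) spanning)
  where
  B∈V : B ∈ V
  B∈V = spanning-step-∈ okS okT U⊆V B∉U C∈U fails

lemma2p9 : (N n : ℕ) → 1 ≤ n → n ≤ N →
    (ρ λ′ : ℕ → ℕ) → IsPartition n ρ → IsPartition n λ′ →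
    (r : ℕ) → 1 ≤ r → r ≤ n → λ′ r + 1 ≡ ρ r →
    (∀ i → 1 ≤ i → i ≤ n → ¬ (i ≡ r) → λ′ i ≡ ρ i) →
    (d e : ℕ) → d < e → e ≤ λ′ 1 →
    (S T : Filling) → IsSSYT N n ρ d S → IsSSYT N n λ′ e T →
    (Ustar : List Pos) → All (InSkew n ρ d) Ustar → (r , ρ r) ∈ Ustar →
    SkewReq (DomS′ n ρ d) (S′ e S T Ustar) →
    SkewReq (DomT′ n ρ d (r , ρ r)) (T′ e S T Ustar) →
    (tree : List (Pos × Pos)) → IsSpanningTree n ρ r d e S T tree →
    ∀ p → p ∈ TreeSet ρ r tree → p ∈ Ustar
lemma2p9 _ _ _ _ ρ _ _ _ r _ _ _ _ _ _ _ _ _ _ _ _ Ustar _ B₀∈U* okS okT tree spanning _ =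
  ∈-∷⁺ʳ B₀∈U* (SpanningFrom-⊆ tree okS okT B₀⊆U* spanning)
  where
  B₀⊆U* : (r , ρ r) ∷ [] ⊆ Ustar
  B₀⊆U* (here refl) = B₀∈U*
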